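{- Every antimatroid is an optimistic greedoid. That is, let $\mathcal{A}$ be a normal greedoid over a finite alphabet $\Sigma$ such that for all $\alpha,\beta\in\mathcal{A}$ with $\tilde\alpha\not\subseteq\tilde\beta$ there exists $x\in\tilde\alpha$ with $\beta x\in\mathcal{A}$; then for every letter $y\in\Sigma$ and every basic word $x_1\cdots x_r\in\mathcal{A}$ there is an index $i$ with $y\in\Gamma[x_1\cdots x_i]$.
   Context: Words: $\Sigma^*$ finite words over $\Sigma$; simple = no repeated letter; $\tilde\alpha$ the set of letters, $|\alpha|$ the length. A greedoid over $\Sigma$ is a nonempty language $\Lambda\subseteq\Sigma^*$ of simple words with (i) $\alpha\beta\in\Lambda\Rightarrow\alpha\in\Lambda$, (ii) if $\alpha,\beta\in\Lambda$, $|\alpha|>|\beta|$, then $\beta x\in\Lambda$ for some $x\in\tilde\alpha$. Basic words are feasible words of maximal length. Normal: every letter of $\Sigma$ occurs in some word of the greedoid. Continuations $\Gamma[\alpha]=\{x\in\Sigma:\alpha x\in\mathcal{A}\}$; $x_1\cdots x_0$ is the empty word. A greedoid is optimistic if for every letter $y$ occurring in some feasible word and every basic word $x_1\cdots x_r$ there is an index $i$ with $y\in\Gamma[x_1\cdots x_i]$. -}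

module Defs where

open import Data.Nat using (ℕ; _<_; _≤_)
open import Data.Fin using (Fin)
open import Data.List using (List; []; _∷_; _++_; [_]; length; take)
open import Data.List.Membership.Propositional using (_∈_)
open import Data.List.Relation.Unary.Unique.Propositional using (Unique)
open import Data.Product using (Σ; _×_; ∃; ∃-syntax)
open import Relation.Nullary using (¬_)

Word : ℕ → Set
Word n = List (Fin n)

Language : ℕ → Set₁
Language n = Word n → Set

_⊆ˡ_ : ∀ {n} → Word n → Word n → Set
α ⊆ˡ β = ∀ {x} → x ∈ α → x ∈ β

record IsGreedoid {n : ℕ} (Λ : Language n) : Set where
  field
    nonempty   : ∃[ α ] Λ α
    simple     : ∀ α → Λ α → Unique α
    hereditary : ∀ α β → Λ (α ++ β) → Λ α
    exchange   : ∀ α β → Λ α → Λ β → length β < length α →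
                 ∃[ x ] (x ∈ α × Λ (β ++ [ x ]))

IsNormal : ∀ {n} → Language n → Set
IsNormal {n} Λ = (y : Fin n) → ∃[ α ] (Λ α × y ∈ α)

IsAntimatroidProperty : ∀ {n} → Language n → Set
IsAntimatroidProperty Λ = ∀ α β → Λ α → Λ β → ¬ (α ⊆ˡ β) →
  ∃[ x ] (x ∈ α × Λ (β ++ [ x ]))

IsBasic : ∀ {n} → Language n → Word n → Set
IsBasic Λ α = Λ α × (∀ β → Λ β → length β ≤ length α)

_∈Γ[_]_ : ∀ {n} → Fin n → Word n → Language n → Set
x ∈Γ[ α ] Λ = Λ (α ++ [ x ])

{-# OPTIONS --safe #-}
-- A basic word w has no feasible one-letter extension, so the antimatroid
-- property forces every feasible word to use only letters of w.  By normality
-- y lies in some feasible word, hence y = x_{i+1} for some i, and then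
-- x_1 ⋯ x_i y is a prefix of w and therefore feasible.
module Submission where

open import Defs
open import Data.Nat using (ℕ; suc; _≤_; z<s)
open import Data.Nat.Properties using (m<m+n; <⇒≱)
open import Data.Fin using (Fin; toℕ)
open import Data.Fin.Properties using (_≟_; toℕ≤n)
open import Data.List using (List; _++_; _∷ʳ_; [_]; length; take; drop)
open import Data.List.Properties using (take++drop≡id; take-suc; length-++)
open import Data.List.Membership.Propositional using (_∈_)
open import Data.List.Relation.Unary.Any using (index)
open import Data.List.Relation.Unary.Any.Properties using (lookup-index)
open import Data.Product using (∃-syntax; _×_; _,_; proj₁)
open import Data.Empty using (⊥-elim)
open import Relation.Nullary using (¬_; yes; no)
open import Relation.Binary.PropositionalEquality using (_≡_; subst; sym; trans; cong)

module _ {n : ℕ} {Λ : Language n} where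

  open import Data.List.Membership.DecPropositional (_≟_ {n}) using (_∈?_)

  take-feasible : IsGreedoid Λ → ∀ i {α} → Λ α → Λ (take i α)
  take-feasible G i {α} Λα =
    IsGreedoid.hereditary G (take i α) (drop i α) (subst Λ (sym (take++drop≡id i α)) Λα)

  basic-unextendable : ∀ {w x} → IsBasic Λ w → ¬ Λ (w ++ [ x ])
  basic-unextendable {w} (_ , maximal) Λwx =
    <⇒≱ (m<m+n (length w) z<s) (subst (_≤ length w) (length-++ w) (maximal _ Λwx))

  feasible⊆ˡbasic : IsAntimatroidProperty Λ → ∀ {α w} → IsBasic Λ w → Λ α → α ⊆ˡ w
  feasible⊆ˡbasic antimatroid {α} {w} basic Λα {x} x∈α with x ∈? w
  ... | yes x∈w = x∈w
  ... | no x∉w with antimatroid α w Λα (proj₁ basic) (λ α⊆w → x∉w (α⊆w x∈α))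
  ...   | _ , _ , Λwz = ⊥-elim (basic-unextendable basic Λwz)

take-suc-index : ∀ {A : Set} {y : A} {w : List A} (y∈w : y ∈ w) →
                 let i = toℕ (index y∈w) in take (suc i) w ≡ take i w ++ [ y ]
take-suc-index {w = w} y∈w =
  trans (take-suc w (index y∈w)) (cong (take (toℕ (index y∈w)) w ∷ʳ_) (sym (lookup-index y∈w)))

mainTheorem11 : (n : ℕ) (Λ : Language n) → IsGreedoid Λ → IsNormal Λ →
    IsAntimatroidProperty Λ →
    (y : Fin n) (w : Word n) → IsBasic Λ w →
    ∃[ i ] (i ≤ length w × y ∈Γ[ take i w ] Λ)
mainTheorem11 n Λ G normal antimatroid y w basic =
  toℕ (index y∈w) , toℕ≤n (index y∈w) ,
  subst Λ (take-suc-index y∈w) (take-feasible G _ (proj₁ basic))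
  where
  y∈w : y ∈ w
  y∈w with normal y
  ... | α , Λα , y∈α = feasible⊆ˡbasic antimatroid basic Λα y∈α
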